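{- Let $X=(V,E)$ be a digraph, and let $e_1,\dots,e_k\in E$ be edges that form a directed $k$-cycle in $X$. Then $$U_X=\sum_{\emptyset\ne S\subseteq\{e_1,\dots,e_k\}}(-1)^{|S|-1}U_{X\setminus S},$$ where $X\setminus S=(V,E\setminus S)$.
   Context: A digraph $X=(V,E)$ has a finite vertex set $V$, $|V|=n$, and edge set $E\subseteq V\times V$ (loops allowed). The edges $e_1,\dots,e_k$ form a directed $k$-cycle if $e_i=(v_i,v_{i+1})$ for $i<k$ and $e_k=(v_k,v_1)$, with $v_1,\dots,v_k$ distinct. A $V$-listing is a bijection $\pi:[n]\to V$, written $(\pi_1,\dots,\pi_n)$, and $X\mathrm{Des}(\pi)=\{i\in[n-1]:(\pi_i,\pi_{i+1})\in E\}$. For $I\subseteq[n-1]$, let $F_I=\sum x_{i_1}\cdots x_{i_n}$, summed over $1\le i_1\le\dots\le i_n$ with $i_j<i_{j+1}$ for $j\in I$. The Redei-Berge function is $U_X=\sum_{\pi}F_{X\mathrm{Des}(\pi)}$ over all $V$-listings $\pi$. -}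

module Defs where

open import Data.Bool using (Bool; true; false; _∧_; _∨_; not; if_then_else_)
open import Data.Nat using (ℕ; zero; suc; _<ᵇ_; _≡ᵇ_; _≤_; _∸_; _≤?_)
open import Data.Product using (_×_; _,_; proj₁; proj₂)
open import Relation.Binary.PropositionalEquality using (_≡_)
open import Data.Fin using (Fin; zero; suc)
open import Data.Fin.Properties using (_≟_)
open import Data.Vec using (Vec; []; _∷_; lookup)
open import Data.List using (List; []; _∷_; map; concatMap; filter; foldr)
open import Data.Integer using (ℤ; _+_; _*_; _^_; -1ℤ; 0ℤ; 1ℤ)
open import Data.Vec.Relation.Unary.Linked using (Linked)
open import Relation.Nullary.Decidable using (⌊_⌋)

-- Digraphs on the vertex set V = Fin n: the edge set E ⊆ V × V is given
-- by its (Boolean) indicator; loops are allowed.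

Digraph : ℕ → Set
Digraph n = Fin n → Fin n → Bool

-- Formal power series in the variables x_1, x_2, … (we write the
-- variable x_{1+i} as index i : ℕ).  A monomial of degree d is
-- x_{s_1} ⋯ x_{s_d} with s_1 ≤ … ≤ s_d (a weakly increasing vector);
-- every monomial has exactly one such representation.  A series is
-- given by its coefficient function; only the values on weakly
-- increasing vectors are meaningful.

Series : Set
Series = (d : ℕ) → Vec ℕ d → ℤ

WeaklyIncreasing : ∀ {d} → Vec ℕ d → Set
WeaklyIncreasing = Linked _≤_

_≈ₛ_ : Series → Series → Set
f ≈ₛ g = ∀ d (s : Vec ℕ d) → WeaklyIncreasing s → f d s ≡ g d s

_+ₛ_ : Series → Series → Series
(f +ₛ g) d s = f d s + g d s

_·ₛ_ : ℤ → Series → Series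
(c ·ₛ f) d s = c * f d s

0ₛ : Series
0ₛ d s = 0ℤ

sumₛ : List Series → Series
sumₛ = foldr _+ₛ_ 0ₛ

-- Subsets I ⊆ [n-1] are encoded as Boolean predicates on ℕ:
-- position j+1 ∈ I  iff  I j ≡ true  (only j < n-1 matters).

strictAt : ∀ {d} → (ℕ → Bool) → Vec ℕ d → Bool
strictAt I []          = true
strictAt I (a ∷ [])    = true
strictAt I (a ∷ b ∷ r) = (not (I 0) ∨ (a <ᵇ b)) ∧ strictAt (λ j → I (suc j)) (b ∷ r)

F : (n : ℕ) → (ℕ → Bool) → Series
F n I d s = if (d ≡ᵇ n) ∧ strictAt I s then 1ℤ else 0ℤ

-- V-listings: bijections [n] → V, written as vectors (π_1,…,π_n) with
-- distinct entries.

allVecs : {A : Set} → List A → (m : ℕ) → List (Vec A m)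
allVecs xs zero    = [] ∷ []
allVecs xs (suc m) = concatMap (λ x → map (x ∷_) (allVecs xs m)) xs

allFins : (n : ℕ) → List (Fin n)
allFins zero    = []
allFins (suc n) = zero ∷ map suc (allFins n)

notIn : ∀ {n m} → Fin n → Vec (Fin n) m → Bool
notIn x []      = true
notIn x (y ∷ r) = not ⌊ x ≟ y ⌋ ∧ notIn x r

distinct : ∀ {n m} → Vec (Fin n) m → Bool
distinct []      = true
distinct (x ∷ r) = notIn x r ∧ distinct r

listings : (n : ℕ) → List (Vec (Fin n) n)
listings n = filter (λ π → distinct π Data.Bool.≟ true) (allVecs (allFins n) n)
  where import Data.Bool

XDes : ∀ {n m} → Digraph n → Vec (Fin n) m → ℕ → Bool
XDes E []          j       = false
XDes E (a ∷ [])    j       = false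
XDes E (a ∷ b ∷ r) zero    = E a b
XDes E (a ∷ b ∷ r) (suc j) = XDes E (b ∷ r) j

U : ∀ {n} → Digraph n → Series
U {n} E = sumₛ (map (λ π → F n (XDes E π)) (listings n))

-- Directed k-cycles (k ≥ 1, written k = suc m): distinct vertices
-- v_1,…,v_k with e_i = (v_i, v_{i+1}) ∈ E and e_k = (v_k, v_1) ∈ E.

cycleEdgesFrom : ∀ {n m} → Fin n → Vec (Fin n) (suc m) → Vec (Fin n × Fin n) (suc m)
cycleEdgesFrom v₁ (a ∷ [])    = (a , v₁) ∷ []
cycleEdgesFrom v₁ (a ∷ b ∷ r) = (a , b) ∷ cycleEdgesFrom v₁ (b ∷ r)

cycleEdges : ∀ {n m} → Vec (Fin n) (suc m) → Vec (Fin n × Fin n) (suc m)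
cycleEdges (v₁ ∷ r) = cycleEdgesFrom v₁ (v₁ ∷ r)

IsDirectedCycle : ∀ {n m} → Digraph n → Vec (Fin n) (suc m) → Set
IsDirectedCycle E v =
  distinct v ≡ true × (∀ i → E (proj₁ (lookup (cycleEdges v) i)) (proj₂ (lookup (cycleEdges v) i)) ≡ true)

-- Subsets S ⊆ {e_1,…,e_k} as characteristic vectors S : Vec Bool k.

sameEdge : ∀ {n} → Fin n × Fin n → Fin n × Fin n → Bool
sameEdge (a , b) (c , d) = ⌊ a ≟ c ⌋ ∧ ⌊ b ≟ d ⌋

inSelected : ∀ {n k} → Vec Bool k → Vec (Fin n × Fin n) k → Fin n × Fin n → Bool
inSelected []      []      e = false
inSelected (s ∷ S) (f ∷ F) e = (s ∧ sameEdge f e) ∨ inSelected S F e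

removeEdges : ∀ {n k} → Digraph n → Vec (Fin n × Fin n) k → Vec Bool k → Digraph n
removeEdges E es S a b = E a b ∧ not (inSelected S es (a , b))

card : ∀ {k} → Vec Bool k → ℕ
card []          = 0
card (true ∷ S)  = suc (card S)
card (false ∷ S) = card S

nonemptySubsets : (k : ℕ) → List (Vec Bool k)
nonemptySubsets k = filter (λ S → 1 ≤? card S) (allVecs (true ∷ false ∷ []) k)

inclusionExclusionRHS : ∀ {n m} → Digraph n → Vec (Fin n) (suc m) → Series
inclusionExclusionRHS {m = m} E v =
  sumₛ (map (λ S → (-1ℤ ^ (card S ∸ 1)) ·ₛ U (removeEdges E (cycleEdges v) S))
            (nonemptySubsets (suc m)))

{-# OPTIONS --safe #-}
module Submission where

-- Fix a listing π.  Its vertices are distinct and visited in order, so the closed walk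
-- e₁ … e_k cannot consist only of pairs that are consecutive in π: some eᵢ is not.
-- Removing eᵢ or not leaves XDes(π) unchanged, so toggling eᵢ ∈ S is a sign-reversing
-- involution on the subsets S ⊆ {e₁, …, e_k} preserving F_{XDes_{X∖S}(π)}.  Hence
-- Σ_S (-1)^|S| F_{XDes_{X∖S}(π)} = 0, i.e. the term S = ∅, which is F_{XDes_X(π)}, equals
-- Σ_{S ≠ ∅} (-1)^{|S|-1} F_{XDes_{X∖S}(π)}.  Summing over π gives the theorem.

open import Defs
open import Data.Nat using (ℕ; suc)
open import Data.Vec using (Vec)
open import Data.Fin using (Fin)

open import Algebra.Properties.CommutativeSemigroup using (interchange)
open import Data.Bool using (Bool; true; false; _∧_; _∨_; not; if_then_else_)
open import Data.Bool.Properties using (∧-identityʳ; ∧-zeroʳ; ∧-conicalˡ; ∧-conicalʳ; ¬-not)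
open import Data.Empty using (⊥-elim)
open import Data.Fin using (zero; suc)
open import Data.Fin.Properties using (_≟_; ¬∀⟶∃¬)
open import Data.Integer using (ℤ; _+_; _*_; _-_; -_; _^_; -1ℤ; 0ℤ; 1ℤ)
open import Data.Integer.Properties
  using (+-assoc; +-identityˡ; +-identityʳ; +-inverseˡ; +-inverseʳ; +-commutativeSemigroup;
         *-assoc; *-identityˡ; *-zeroʳ; *-distribˡ-+; -1*i≡-i; neg-distrib-+; neg-involutive)
open import Data.List using (List; []; _∷_; map; filter; _++_)
open import Data.List.Relation.Unary.All using (All; []; _∷_)
open import Data.List.Relation.Unary.All.Properties using (all-filter)
open import Data.Nat using (_<ᵇ_; _≡ᵇ_; _≤?_; _∸_)
open import Data.Product using (_×_; _,_; ∃; uncurry)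
open import Data.Vec using ([]; _∷_; head; lookup; replicate)
open import Data.Vec.Membership.Propositional using (_∈_; _∉_)
open import Data.Vec.Relation.Unary.Any using (here; there)
open import Function using (_∘_)
open import Relation.Binary.PropositionalEquality
open import Relation.Nullary using (¬_; Dec; yes; no; does)
open import Relation.Unary using (Decidable)

∑ : {A : Set} → List A → (A → ℤ) → ℤ
∑ []       f = 0ℤ
∑ (x ∷ xs) f = f x + ∑ xs f

syntax ∑ xs (λ x → e) = ∑[ x ← xs ] e

module _ {A : Set} where

  ∑-cong : (xs : List A) {f g : A → ℤ} → f ≗ g → ∑ xs f ≡ ∑ xs g
  ∑-cong []       f≗g = refl
  ∑-cong (x ∷ xs) f≗g = cong₂ _+_ (f≗g x) (∑-cong xs f≗g)

  ∑-cong-All : {P : A → Set} {xs : List A} {f g : A → ℤ} →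
               All P xs → (∀ x → P x → f x ≡ g x) → ∑ xs f ≡ ∑ xs g
  ∑-cong-All []         agree = refl
  ∑-cong-All (px ∷ pxs) agree = cong₂ _+_ (agree _ px) (∑-cong-All pxs agree)

  ∑-zero : (xs : List A) → ∑[ _ ← xs ] 0ℤ ≡ 0ℤ
  ∑-zero []       = refl
  ∑-zero (x ∷ xs) = trans (+-identityˡ _) (∑-zero xs)

  ∑-distrib-+ : (xs : List A) (f g : A → ℤ) → ∑[ x ← xs ] (f x + g x) ≡ ∑ xs f + ∑ xs g
  ∑-distrib-+ []       f g = refl
  ∑-distrib-+ (x ∷ xs) f g =
    trans (cong (f x + g x +_) (∑-distrib-+ xs f g))
          (interchange +-commutativeSemigroup (f x) (g x) (∑ xs f) (∑ xs g))

  ∑-neg : (xs : List A) (f : A → ℤ) → ∑[ x ← xs ] (- f x) ≡ - ∑ xs f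
  ∑-neg []       f = refl
  ∑-neg (x ∷ xs) f = trans (cong (- f x +_) (∑-neg xs f)) (sym (neg-distrib-+ (f x) (∑ xs f)))

  *-distribˡ-∑ : (c : ℤ) (xs : List A) (f : A → ℤ) → c * ∑ xs f ≡ ∑[ x ← xs ] (c * f x)
  *-distribˡ-∑ c []       f = *-zeroʳ c
  *-distribˡ-∑ c (x ∷ xs) f = trans (*-distribˡ-+ c (f x) (∑ xs f)) (cong (c * f x +_) (*-distribˡ-∑ c xs f))

  ∑-++ : (xs ys : List A) (f : A → ℤ) → ∑ (xs ++ ys) f ≡ ∑ xs f + ∑ ys f
  ∑-++ []       ys f = sym (+-identityˡ _)
  ∑-++ (x ∷ xs) ys f = trans (cong (f x +_) (∑-++ xs ys f)) (sym (+-assoc (f x) (∑ xs f) (∑ ys f)))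

  ∑-filter : {P : A → Set} (P? : Decidable P) (xs : List A) (f : A → ℤ) →
             ∑ (filter P? xs) f ≡ ∑[ x ← xs ] (if does (P? x) then f x else 0ℤ)
  ∑-filter P? []       f = refl
  ∑-filter P? (x ∷ xs) f with does (P? x)
  ... | true  = cong (f x +_) (∑-filter P? xs f)
  ... | false = trans (∑-filter P? xs f) (sym (+-identityˡ _))

  ∑-map : {B : Set} (g : A → B) (xs : List A) (f : B → ℤ) → ∑ (map g xs) f ≡ ∑[ x ← xs ] f (g x)
  ∑-map g []       f = refl
  ∑-map g (x ∷ xs) f = cong (f (g x) +_) (∑-map g xs f)

  sumₛ-map-apply : (xs : List A) (f : A → Series) (d : ℕ) (s : Vec ℕ d) →
                   sumₛ (map f xs) d s ≡ ∑[ x ← xs ] f x d s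
  sumₛ-map-apply []       f d s = refl
  sumₛ-map-apply (x ∷ xs) f d s = cong (f x d s +_) (sumₛ-map-apply xs f d s)

∑-comm : {A B : Set} (xs : List A) (ys : List B) (f : A → B → ℤ) →
         ∑[ x ← xs ] ∑[ y ← ys ] f x y ≡ ∑[ y ← ys ] ∑[ x ← xs ] f x y
∑-comm []       ys f = sym (∑-zero ys)
∑-comm (x ∷ xs) ys f =
  trans (cong (∑ ys (f x) +_) (∑-comm xs ys f))
        (sym (∑-distrib-+ ys (f x) (λ y → ∑[ x ← xs ] f x y)))

subsets : (k : ℕ) → List (Vec Bool k)
subsets = allVecs (true ∷ false ∷ [])

∅ : (k : ℕ) → Vec Bool k
∅ k = replicate k false

toggle : ∀ {k} → Fin k → Vec Bool k → Vec Bool k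
toggle zero    (b ∷ S) = not b ∷ S
toggle (suc i) (b ∷ S) = b ∷ toggle i S

∑-subsets-suc : ∀ k (f : Vec Bool (suc k) → ℤ) →
  ∑ (subsets (suc k)) f ≡ ∑[ S ← subsets k ] f (true ∷ S) + ∑[ S ← subsets k ] f (false ∷ S)
∑-subsets-suc k f = begin
  ∑ (map (true ∷_) A ++ (map (false ∷_) A ++ [])) f
    ≡⟨ ∑-++ (map (true ∷_) A) _ f ⟩
  ∑ (map (true ∷_) A) f + ∑ (map (false ∷_) A ++ []) f
    ≡⟨ cong (∑ (map (true ∷_) A) f +_) (trans (∑-++ (map (false ∷_) A) [] f) (+-identityʳ _)) ⟩
  ∑ (map (true ∷_) A) f + ∑ (map (false ∷_) A) f
    ≡⟨ cong₂ _+_ (∑-map (true ∷_) A f) (∑-map (false ∷_) A f) ⟩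
  ∑[ S ← A ] f (true ∷ S) + ∑[ S ← A ] f (false ∷ S) ∎
  where open ≡-Reasoning
        A : List (Vec Bool k)
        A = subsets k

signedSum : ∀ {k} → (Vec Bool k → ℤ) → ℤ
signedSum {k} H = ∑[ S ← subsets k ] (-1ℤ ^ card S * H S)

signedSum-suc : ∀ {k} (H : Vec Bool (suc k) → ℤ) →
                signedSum H ≡ - signedSum (H ∘ (true ∷_)) + signedSum (H ∘ (false ∷_))
signedSum-suc {k} H =
  trans (∑-subsets-suc k (λ S → -1ℤ ^ card S * H S))
        (cong (_+ signedSum (H ∘ (false ∷_)))
              (trans (∑-cong A flipSign) (∑-neg A (λ S → -1ℤ ^ card S * H (true ∷ S)))))
  where
  A : List (Vec Bool k)
  A = subsets k
  flipSign : ∀ S → -1ℤ * -1ℤ ^ card S * H (true ∷ S) ≡ - (-1ℤ ^ card S * H (true ∷ S))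
  flipSign S = trans (*-assoc -1ℤ (-1ℤ ^ card S) (H (true ∷ S))) (-1*i≡-i _)

signedSum-toggle-invariant : ∀ {k} (i : Fin k) (H : Vec Bool k → ℤ) →
                             (∀ S → H (toggle i S) ≡ H S) → signedSum H ≡ 0ℤ
signedSum-toggle-invariant {suc k} zero H inv = begin
  signedSum H
    ≡⟨ signedSum-suc H ⟩
  - signedSum (H ∘ (true ∷_)) + signedSum (H ∘ (false ∷_))
    ≡⟨ cong (λ t → - t + signedSum (H ∘ (false ∷_)))
            (∑-cong (subsets k) (λ S → cong (-1ℤ ^ card S *_) (inv (false ∷ S)))) ⟩
  - signedSum (H ∘ (false ∷_)) + signedSum (H ∘ (false ∷_))
    ≡⟨ +-inverseˡ (signedSum (H ∘ (false ∷_))) ⟩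
  0ℤ ∎
  where open ≡-Reasoning
signedSum-toggle-invariant {suc k} (suc i) H inv =
  trans (signedSum-suc H)
        (cong₂ (λ t u → - t + u)
               (signedSum-toggle-invariant i (H ∘ (true ∷_)) (inv ∘ (true ∷_)))
               (signedSum-toggle-invariant i (H ∘ (false ∷_)) (inv ∘ (false ∷_))))

isZero : ℕ → ℤ
isZero ℕ.zero = 1ℤ
isZero (suc _) = 0ℤ

∑-subsets-isZero-card : ∀ k (H : Vec Bool k → ℤ) → ∑[ S ← subsets k ] (isZero (card S) * H S) ≡ H (∅ k)
∑-subsets-isZero-card ℕ.zero H = trans (+-identityʳ _) (*-identityˡ _)
∑-subsets-isZero-card (suc k) H =
  trans (∑-subsets-suc k (λ S → isZero (card S) * H S))
        (trans (cong₂ _+_ (∑-zero (subsets k)) (∑-subsets-isZero-card k (H ∘ (false ∷_))))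
               (+-identityˡ _))

nonempty-coefficient : ∀ c G →
  (if does (1 ≤? c) then -1ℤ ^ (c ∸ 1) * G else 0ℤ) ≡ isZero c * G - -1ℤ ^ c * G
nonempty-coefficient ℕ.zero  G = sym (+-inverseʳ (1ℤ * G))
nonempty-coefficient (suc c) G = sym (begin
  0ℤ * G - -1ℤ * x * G     ≡⟨ +-identityˡ _ ⟩
  - (-1ℤ * x * G)          ≡⟨ cong -_ (*-assoc -1ℤ x G) ⟩
  - (-1ℤ * (x * G))        ≡⟨ cong -_ (-1*i≡-i (x * G)) ⟩
  - - (x * G)              ≡⟨ neg-involutive _ ⟩
  x * G ∎)
  where open ≡-Reasoning
        x : ℤ
        x = -1ℤ ^ c

inclusion–exclusion-toggle-invariant :
  ∀ {k} (i : Fin k) (H : Vec Bool k → ℤ) → (∀ S → H (toggle i S) ≡ H S) →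
  ∑[ S ← nonemptySubsets k ] (-1ℤ ^ (card S ∸ 1) * H S) ≡ H (∅ k)
inclusion–exclusion-toggle-invariant {k} i H inv = begin
  ∑[ S ← nonemptySubsets k ] (-1ℤ ^ (card S ∸ 1) * H S)
    ≡⟨ ∑-filter (λ S → 1 ≤? card S) A _ ⟩
  ∑[ S ← A ] (if does (1 ≤? card S) then -1ℤ ^ (card S ∸ 1) * H S else 0ℤ)
    ≡⟨ ∑-cong A (λ S → nonempty-coefficient (card S) (H S)) ⟩
  ∑[ S ← A ] (isZero (card S) * H S - -1ℤ ^ card S * H S)
    ≡⟨ ∑-distrib-+ A _ _ ⟩
  ∑[ S ← A ] (isZero (card S) * H S) + ∑[ S ← A ] (- (-1ℤ ^ card S * H S))
    ≡⟨ cong₂ _+_ (∑-subsets-isZero-card k H) (∑-neg A _) ⟩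
  H (∅ k) - signedSum H
    ≡⟨ cong (λ t → H (∅ k) - t) (signedSum-toggle-invariant i H inv) ⟩
  H (∅ k) + 0ℤ
    ≡⟨ +-identityʳ _ ⟩
  H (∅ k) ∎
  where open ≡-Reasoning
        A : List (Vec Bool k)
        A = subsets k

module _ {A : Set} where

  data Precedes : ∀ {m} → Vec A m → A → A → Set where
    first : ∀ {m a b} {r : Vec A m} → b ∈ r → Precedes (a ∷ r) a b
    later : ∀ {m a b c} {r : Vec A m} → Precedes r a b → Precedes (c ∷ r) a b

  data Consecutive : ∀ {m} → Vec A m → A → A → Set where
    first : ∀ {m a b} {r : Vec A m} → Consecutive (a ∷ b ∷ r) a b
    later : ∀ {m a b c} {r : Vec A m} → Consecutive r a b → Consecutive (c ∷ r) a b

  Precedes⇒∈ : ∀ {m} {π : Vec A m} {a b} → Precedes π a b → b ∈ π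
  Precedes⇒∈ (first b∈r) = there b∈r
  Precedes⇒∈ (later p)   = there (Precedes⇒∈ p)

  Consecutive⇒Precedes : ∀ {m} {π : Vec A m} {a b} → Consecutive π a b → Precedes π a b
  Consecutive⇒Precedes first     = first (here refl)
  Consecutive⇒Precedes (later p) = later (Consecutive⇒Precedes p)

module _ {n : ℕ} where

  notIn⇒∉ : ∀ {m} {x : Fin n} {r : Vec (Fin n) m} → notIn x r ≡ true → x ∉ r
  notIn⇒∉ {x = x} h (here refl) with x ≟ x | h
  ... | yes _   | ()
  ... | no x≢x | _ = x≢x refl
  notIn⇒∉ h (there x∈r) = notIn⇒∉ (∧-conicalʳ _ _ h) x∈r

  cycleEdgesFrom-closes : {R : Fin n → Fin n → Set} → (∀ {a b c} → R a b → R b c → R a c) →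
    ∀ {m} (v₁ : Fin n) (w : Vec (Fin n) (suc m)) → (∀ i → uncurry R (lookup (cycleEdgesFrom v₁ w) i)) → R (head w) v₁
  cycleEdgesFrom-closes R-trans v₁ (a ∷ [])    edges = edges zero
  cycleEdgesFrom-closes R-trans v₁ (a ∷ b ∷ r) edges =
    R-trans (edges zero) (cycleEdgesFrom-closes R-trans v₁ (b ∷ r) (edges ∘ suc))

  Precedes-trans : ∀ {m} {π : Vec (Fin n) m} {a b c} → distinct π ≡ true →
                   Precedes π a b → Precedes π b c → Precedes π a c
  Precedes-trans dist (first b∈r) (first _)   = ⊥-elim (notIn⇒∉ (∧-conicalˡ _ _ dist) b∈r)
  Precedes-trans dist (first _)   (later b≺c) = first (Precedes⇒∈ b≺c)
  Precedes-trans dist (later a≺b) (first _)   = ⊥-elim (notIn⇒∉ (∧-conicalˡ _ _ dist) (Precedes⇒∈ a≺b))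
  Precedes-trans dist (later a≺b) (later b≺c) = later (Precedes-trans (∧-conicalʳ _ _ dist) a≺b b≺c)

  Precedes-irrefl : ∀ {m} {π : Vec (Fin n) m} {a} → distinct π ≡ true → ¬ Precedes π a a
  Precedes-irrefl dist (first a∈r) = notIn⇒∉ (∧-conicalˡ _ _ dist) a∈r
  Precedes-irrefl dist (later a≺a) = Precedes-irrefl (∧-conicalʳ _ _ dist) a≺a

  Consecutive? : ∀ {m} (π : Vec (Fin n) m) a b → Dec (Consecutive π a b)
  Consecutive? []          a b = no λ ()
  Consecutive? (x ∷ [])    a b = no λ { (later ()) }
  Consecutive? (x ∷ y ∷ r) a b with x ≟ a | y ≟ b | Consecutive? (y ∷ r) a b
  ... | yes refl | yes refl | _      = yes first
  ... | _        | _        | yes p  = yes (later p)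
  ... | no x≢a   | _        | no ¬p  = no λ { first → x≢a refl ; (later p) → ¬p p }
  ... | yes _    | no y≢b   | no ¬p  = no λ { first → y≢b refl ; (later p) → ¬p p }

  listing-omits-cycleEdge : ∀ {m k} {π : Vec (Fin n) m} → distinct π ≡ true → (v : Vec (Fin n) (suc k)) →
                            ∃ λ i → ¬ uncurry (Consecutive π) (lookup (cycleEdges v) i)
  listing-omits-cycleEdge {k = k} {π} dist (v₁ ∷ r) =
    ¬∀⟶∃¬ (suc k) (uncurry (Consecutive π) ∘ lookup (cycleEdges (v₁ ∷ r))) (λ i → Consecutive? π _ _)
      (Precedes-irrefl dist ∘ cycleEdgesFrom-closes {R = Precedes π} (Precedes-trans dist) v₁ (v₁ ∷ r)
                            ∘ (Consecutive⇒Precedes ∘_))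

  XDes-cong : ∀ {m} (π : Vec (Fin n) m) {E₁ E₂ : Digraph n} →
              (∀ {a b} → Consecutive π a b → E₁ a b ≡ E₂ a b) → ∀ j → XDes E₁ π j ≡ XDes E₂ π j
  XDes-cong []          agree j       = refl
  XDes-cong (a ∷ [])    agree j       = refl
  XDes-cong (a ∷ b ∷ r) agree ℕ.zero  = agree first
  XDes-cong (a ∷ b ∷ r) agree (suc j) = XDes-cong (b ∷ r) (agree ∘ later) j

  sameEdge⇒≡ : (e f : Fin n × Fin n) → sameEdge e f ≡ true → e ≡ f
  sameEdge⇒≡ (a , b) (c , d) h with a ≟ c | b ≟ d | h
  ... | yes refl | yes refl | _  = refl
  ... | yes _    | no _     | ()
  ... | no _     | _        | ()

  inSelected-∅ : ∀ {k} (es : Vec (Fin n × Fin n) k) e → inSelected (∅ k) es e ≡ false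
  inSelected-∅ []       e = refl
  inSelected-∅ (f ∷ es) e = inSelected-∅ es e

  inSelected-toggle : ∀ {k} (i : Fin k) (S : Vec Bool k) (es : Vec (Fin n × Fin n) k) e →
    lookup es i ≢ e → inSelected (toggle i S) es e ≡ inSelected S es e
  inSelected-toggle zero (s ∷ S) (f ∷ es) e f≢e
    rewrite ¬-not (f≢e ∘ sameEdge⇒≡ f e) | ∧-zeroʳ (not s) | ∧-zeroʳ s = refl
  inSelected-toggle (suc i) (s ∷ S) (f ∷ es) e f≢e =
    cong ((s ∧ sameEdge f e) ∨_) (inSelected-toggle i S es e f≢e)

  removeEdges-∅ : ∀ {k} (E : Digraph n) (es : Vec (Fin n × Fin n) k) a b → removeEdges E es (∅ k) a b ≡ E a b
  removeEdges-∅ E es a b = trans (cong (λ t → E a b ∧ not t) (inSelected-∅ es (a , b))) (∧-identityʳ (E a b))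

  removeEdges-toggle : ∀ {k} (E : Digraph n) (es : Vec (Fin n × Fin n) k) (i : Fin k) (S : Vec Bool k) a b →
    lookup es i ≢ (a , b) → removeEdges E es (toggle i S) a b ≡ removeEdges E es S a b
  removeEdges-toggle E es i S a b eᵢ≢ab = cong (λ t → E a b ∧ not t) (inSelected-toggle i S es (a , b) eᵢ≢ab)

strictAt-cong : ∀ {d} {I J : ℕ → Bool} (s : Vec ℕ d) → I ≗ J → strictAt I s ≡ strictAt J s
strictAt-cong []          I≗J = refl
strictAt-cong (a ∷ [])    I≗J = refl
strictAt-cong (a ∷ b ∷ r) I≗J =
  cong₂ (λ x y → (not x ∨ (a <ᵇ b)) ∧ y) (I≗J 0) (strictAt-cong (b ∷ r) (I≗J ∘ suc))

F-cong : ∀ n {I J : ℕ → Bool} → I ≗ J → ∀ d (s : Vec ℕ d) → F n I d s ≡ F n J d s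
F-cong n I≗J d s = cong (λ t → if (d ≡ᵇ n) ∧ t then 1ℤ else 0ℤ) (strictAt-cong s I≗J)

listing-inclusion–exclusion :
  ∀ {n m} (E : Digraph n) (v : Vec (Fin n) (suc m)) {π : Vec (Fin n) n} → distinct π ≡ true →
  ∀ d (s : Vec ℕ d) →
  ∑[ S ← nonemptySubsets (suc m) ] (-1ℤ ^ (card S ∸ 1) * F n (XDes (removeEdges E (cycleEdges v) S) π) d s)
    ≡ F n (XDes E π) d s
listing-inclusion–exclusion {n} {m} E v {π} dist d s with listing-omits-cycleEdge dist v
... | i , eᵢ∉π =
  trans (inclusion–exclusion-toggle-invariant i H H-toggle)
        (F-cong n (XDes-cong π (λ {a} {b} _ → removeEdges-∅ E es a b)) d s)
  where
  es : Vec (Fin n × Fin n) (suc m)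
  es = cycleEdges v
  H : Vec Bool (suc m) → ℤ
  H S = F n (XDes (removeEdges E es S) π) d s
  H-toggle : ∀ S → H (toggle i S) ≡ H S
  H-toggle S = F-cong n (XDes-cong π (λ {a} {b} ab-consecutive →
    removeEdges-toggle E es i S a b (λ eᵢ≡ab → eᵢ∉π (subst (uncurry (Consecutive π)) (sym eᵢ≡ab) ab-consecutive)))) d s

mainTheorem6 : (n : ℕ) (E : Digraph n) (m : ℕ) (v : Vec (Fin n) (suc m)) → IsDirectedCycle E v → U E ≈ₛ inclusionExclusionRHS E v
mainTheorem6 n E m v _ d s _ = begin
  U E d s
    ≡⟨ sumₛ-map-apply L (λ π → F n (XDes E π)) d s ⟩
  ∑[ π ← L ] F n (XDes E π) d s
    ≡⟨ ∑-cong-All (all-filter isListing? (allVecs (allFins n) n))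
                  (λ π dist → sym (listing-inclusion–exclusion E v {π} dist d s)) ⟩
  ∑[ π ← L ] ∑[ S ← NE ] (c S * F n (XDes (X∖ S) π) d s)
    ≡⟨ ∑-comm L NE (λ π S → c S * F n (XDes (X∖ S) π) d s) ⟩
  ∑[ S ← NE ] ∑[ π ← L ] (c S * F n (XDes (X∖ S) π) d s)
    ≡⟨ ∑-cong NE (λ S → sym (trans (cong (c S *_) (sumₛ-map-apply L (λ π → F n (XDes (X∖ S) π)) d s))
                                     (*-distribˡ-∑ (c S) L _))) ⟩
  ∑[ S ← NE ] (c S * U (X∖ S) d s)
    ≡⟨ sym (sumₛ-map-apply NE (λ S → c S ·ₛ U (X∖ S)) d s) ⟩
  inclusionExclusionRHS E v d s ∎
  where
  open ≡-Reasoning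
  isListing? : (π : Vec (Fin n) n) → Dec (distinct π ≡ true)
  isListing? π = distinct π Data.Bool.≟ true
  L : List (Vec (Fin n) n)
  L = listings n
  NE : List (Vec Bool (suc m))
  NE = nonemptySubsets (suc m)
  c : Vec Bool (suc m) → ℤ
  c S = -1ℤ ^ (card S ∸ 1)
  X∖ : Vec Bool (suc m) → Digraph n
  X∖ S = removeEdges E (cycleEdges v) S
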